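{- Let $w_0\ge w_1\ge\cdots\ge w_M>0$ ($M\ge1$) be weights such that $w_i\ge w_{i+1}+w_{i+2}$ for all $0\le i\le M-2$. Then the Huffman tree for these weights is a comb with a predefined merge order: Huffman's algorithm first merges $w_M$ and $w_{M-1}$, and at each subsequent step merges the node formed in the previous step with the next weight $w_{M-2},w_{M-3},\dots,w_0$ in turn.
   Context: Huffman's algorithm starts with one singleton tree per weight and repeatedly joins the two trees of least total weight under a new node whose weight is the sum of theirs, until one tree remains.
   Formalization: The weights $w_0\ge w_1\ge\cdots\ge w_M>0$ are rational numbers. -}

module Defs where

open import Data.Nat using (ℕ; zero; suc; _∸_)
open import Data.Rational using (ℚ; _+_; _≤_)
open import Data.List using (List; []; _∷_; [_]; map; upTo)
open import Data.List.Relation.Unary.All using (All)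
open import Data.Product using (_×_; _,_)
open import Data.Sum using (_⊎_)

data Tree : Set where
  leaf : ℕ → Tree
  node : Tree → Tree → Tree

weight : (ℕ → ℚ) → Tree → ℚ
weight w (leaf i)   = w i
weight w (node a b) = weight w a + weight w b

data Select : Tree → List Tree → List Tree → Set where
  here  : ∀ {t ts} → Select t (t ∷ ts) ts
  there : ∀ {t u ts rs} → Select t ts rs → Select t (u ∷ ts) (u ∷ rs)

-- One step of Huffman's algorithm (nondeterministic in ties):
-- pick a tree a of least weight in F, then a tree b of least weight among
-- the remaining trees, and replace both by the new node joining them.
data HuffStep (w : ℕ → ℚ) : List Tree → Tree → Tree → List Tree → Set where
  huffStep : ∀ {F R₁ R₂ a b} →
    Select a F R₁ → All (λ t → weight w a ≤ weight w t) R₁ →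
    Select b R₁ R₂ → All (λ t → weight w b ≤ weight w t) R₂ →
    HuffStep w F a b (node a b ∷ R₂)

data HuffRun (w : ℕ → ℚ) : List Tree → List (Tree × Tree) → Tree → Set where
  done : ∀ {T} → HuffRun w [ T ] [] T
  step : ∀ {F F' a b ms T} → HuffStep w F a b F' → HuffRun w F' ms T →
         HuffRun w F ((a , b) ∷ ms) T

initialForest : ℕ → List Tree
initialForest M = map leaf (upTo (suc M))

-- Equality of trees up to swapping the two children of nodes
-- (the left/right order of the merged trees is immaterial).
data _≅_ : Tree → Tree → Set where
  leaf : ∀ {i} → leaf i ≅ leaf i
  node : ∀ {a a' b b'} → a ≅ a' → b ≅ b' → node a b ≅ node a' b'
  swap : ∀ {a a' b b'} → a ≅ a' → b ≅ b' → node a b ≅ node b' a'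

chain : ℕ → ℕ → Tree
chain M zero    = leaf M
chain M (suc k) = node (chain M k) (leaf (M ∸ suc k))

combMerges : ℕ → List (Tree × Tree)
combMerges M = map (λ k → chain M k , leaf (M ∸ suc k)) (upTo M)

SameMerge : Tree × Tree → Tree × Tree → Set
SameMerge (x , y) (c , l) = (x ≅ c × y ≅ l) ⊎ (x ≅ l × y ≅ c)

{-# OPTIONS --safe #-}
-- Let c be the weight of the comb built from w_M, …, w_(m+1), with the leaves
-- w_0, …, w_m still unmerged.  Invariant: c < w_i for all i < m.  Since also
-- w_m < w_i for i < m (from w_i ≥ w_(i+1) + w_(i+2) and positivity), the comb
-- and w_m are strictly the two lightest trees, so every Huffman step must join
-- exactly these two.  The invariant survives the step because
-- c + w_m < w_(m-1) + w_m ≤ w_(m-2).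
module Submission where

open import Defs
open import Data.Nat using (ℕ; suc; _+_; _≤_)
open import Data.Rational using (ℚ; 0ℚ; _<_) renaming (_+_ to _+ℚ_; _≤_ to _≤ℚ_)
open import Data.List using (List)
open import Data.Product using (Σ; _×_; _,_)
open import Data.List.Relation.Binary.Pointwise using (Pointwise)

open import Function using (id; _∘_)
open import Data.Empty using (⊥-elim)
open import Data.Sum using (_⊎_; inj₁; inj₂)
open import Data.Product using (∃; ∃₂; proj₁; proj₂) renaming (swap to ×-swap)
open import Data.Nat using (zero; _∸_; s≤s; _≤′_; ≤′-refl; ≤′-step) renaming (_<_ to _<ℕ_)
open import Data.Nat.Properties
  using (≤⇒≤′; +-suc; +-identityʳ; m+n∸m≡n; m+n≤o⇒n≤o)
  renaming (+-comm to +ℕ-comm; ≤-refl to ≤ℕ-refl; ≤-trans to ≤ℕ-trans; <⇒≤ to <ℕ⇒≤ℕ)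
open import Data.Rational.Properties
  using (≤-refl; ≤-trans; ≤-total; <-irrefl; <-≤-trans; ≤-<-trans; <⇒≤; +-comm; +-monoˡ-<; +-monoʳ-<; module ≤-Reasoning)
  renaming (+-identityʳ to +ℚ-identityʳ)
open import Data.List using ([]; _∷_; [_]; map; upTo; applyUpTo; _∷ʳ_)
open import Data.List.Properties using (upTo-∷ʳ; map-++; map-upTo)
open import Data.List.Relation.Unary.All as All using (All; _∷_)
open import Data.List.Relation.Unary.All.Properties using (map⁺; applyUpTo⁺₁)
open import Data.List.Relation.Unary.Any using (here; there)
open import Data.List.Membership.Propositional using (_∈_)
open import Data.List.Relation.Binary.Permutation.Propositional
  using (_↭_; ↭-refl; ↭-prep; ↭-swap; ↭-sym; ↭-trans; module PermutationReasoning)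
open import Data.List.Relation.Binary.Permutation.Propositional.Properties
  using (drop-∷; ∈-resp-↭; All-resp-↭; ↭-singleton-inv; ↭-length; ∷↭∷ʳ)
open import Data.List.Relation.Binary.Pointwise using ([]; _∷_)
open import Relation.Nullary using (¬_)
open import Relation.Binary.PropositionalEquality
  using (_≡_; _≗_; refl; sym; trans; cong; cong₂; subst; module ≡-Reasoning)

applyUpTo-cong : ∀ {A : Set} {f g : ℕ → A} → f ≗ g → ∀ n → applyUpTo f n ≡ applyUpTo g n
applyUpTo-cong f≗g zero    = refl
applyUpTo-cong f≗g (suc n) = cong₂ _∷_ (f≗g 0) (applyUpTo-cong (f≗g ∘ suc) n)

select-∈ : ∀ {t F R} → Select t F R → t ∈ F
select-∈ here      = here refl
select-∈ (there s) = there (select-∈ s)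

select-↭ : ∀ {t F R} → Select t F R → F ↭ t ∷ R
select-↭ here      = ↭-refl
select-↭ (there s) = ↭-trans (↭-prep _ (select-↭ s)) (↭-swap _ _ ↭-refl)

select-rest-↭ : ∀ {t F R S} → F ↭ t ∷ S → Select t F R → R ↭ S
select-rest-↭ F↭ s = drop-∷ (↭-trans (↭-sym (select-↭ s)) F↭)

∈⇒select : ∀ {t : Tree} {F} → t ∈ F → ∃ (Select t F)
∈⇒select (here refl) = _ , here
∈⇒select (there t∈F) = _ , there (proj₂ (∈⇒select t∈F))

select-from-↭ : ∀ {t F S} → F ↭ t ∷ S → ∃ λ R → Select t F R × R ↭ S
select-from-↭ F↭ =
  let R , s = ∈⇒select (∈-resp-↭ (↭-sym F↭) (here refl)) in R , s , select-rest-↭ F↭ s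

SamePair : Tree × Tree → Tree × Tree → Set
SamePair (a , b) (x , y) = (a ≡ x × b ≡ y) ⊎ (a ≡ y × b ≡ x)

samePair-sameMerge : ∀ {a b x y x' y'} → SamePair (a , b) (x , y) → x ≅ x' → y ≅ y' →
                     SameMerge (a , b) (x' , y')
samePair-sameMerge (inj₁ (refl , refl)) x≅ y≅ = inj₁ (x≅ , y≅)
samePair-sameMerge (inj₂ (refl , refl)) x≅ y≅ = inj₂ (y≅ , x≅)

samePair-node≅ : ∀ {a b x y x' y'} → SamePair (a , b) (x , y) → x ≅ x' → y ≅ y' →
                 node a b ≅ node x' y'
samePair-node≅ (inj₁ (refl , refl)) x≅ y≅ = node x≅ y≅
samePair-node≅ (inj₂ (refl , refl)) x≅ y≅ = swap y≅ x≅

module HuffmanStep (w : ℕ → ℚ) where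

  W : Tree → ℚ
  W = weight w

  LowerBound : Tree → List Tree → Set
  LowerBound a F = All (λ t → W a ≤ℚ W t) F

  BothLighter : Tree → Tree → Tree → Set
  BothLighter x y t = W x < W t × W y < W t

  samePair-weight : ∀ {a b x y} → SamePair (a , b) (x , y) → W (node a b) ≡ W (node x y)
  samePair-weight (inj₁ (refl , refl)) = refl
  samePair-weight {x = x} {y} (inj₂ (refl , refl)) = +-comm (W y) (W x)

  lowerBound-↭ : ∀ {a F R} → F ↭ a ∷ R → LowerBound a R → LowerBound a F
  lowerBound-↭ F↭ a≤R = All-resp-↭ (↭-sym F↭) (≤-refl ∷ a≤R)

  lowerBound-≮ : ∀ {a t F} → LowerBound a F → t ∈ F → ¬ (W t < W a)
  lowerBound-≮ a≤F t∈F t<a = <-irrefl refl (<-≤-trans t<a (All.lookup a≤F t∈F))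

  lowerBound-unique : ∀ {a x S} → a ∈ x ∷ S → LowerBound a (x ∷ S) → All (λ t → W x < W t) S →
                      a ≡ x
  lowerBound-unique (here a≡x)  _   _   = a≡x
  lowerBound-unique {a} (there a∈S) a≤F x<S =
    ⊥-elim (lowerBound-≮ {a} a≤F (here refl) (All.lookup x<S a∈S))

  select-strictlyLightest : ∀ {S y R b R'} → S ↭ y ∷ R → Select b S R' → LowerBound b R' →
                            All (λ t → W y < W t) R → b ≡ y × R' ↭ R
  select-strictlyLightest {b = b} S↭ s b≤R' y<R
    with refl ← lowerBound-unique {b} (∈-resp-↭ S↭ (select-∈ s))
                                  (All-resp-↭ S↭ (lowerBound-↭ (select-↭ s) b≤R')) y<R
    = refl , select-rest-↭ S↭ s

  huffStep-forced : ∀ {F a b F' x y R} → HuffStep w F a b F' → F ↭ x ∷ y ∷ R →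
                    All (BothLighter x y) R → SamePair (a , b) (x , y) × F' ↭ node a b ∷ R
  huffStep-forced {a = a} (huffStep s₁ a≤R₁ s₂ b≤R₂) F↭ xy<R with ∈-resp-↭ F↭ (select-∈ s₁)
  ... | here refl =
    let b≡y , R₂↭R = select-strictlyLightest (select-rest-↭ F↭ s₁) s₂ b≤R₂ (All.map proj₂ xy<R)
    in inj₁ (refl , b≡y) , ↭-prep _ R₂↭R
  ... | there (here refl) =
    let F↭yx = ↭-trans F↭ (↭-swap _ _ ↭-refl)
        b≡x , R₂↭R = select-strictlyLightest (select-rest-↭ F↭yx s₁) s₂ b≤R₂ (All.map proj₁ xy<R)
    in inj₂ (refl , b≡x) , ↭-prep _ R₂↭R
  ... | there (there a∈R) =
    ⊥-elim (lowerBound-≮ {a} (lowerBound-↭ (select-↭ s₁) a≤R₁) (∈-resp-↭ (↭-sym F↭) (here refl))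
                         (proj₁ (All.lookup xy<R a∈R)))

  huffStep-ordered : ∀ {F x y R} → W x ≤ℚ W y → F ↭ x ∷ y ∷ R → All (BothLighter x y) R →
                     ∃ λ R₂ → HuffStep w F x y (node x y ∷ R₂) × R₂ ↭ R
  huffStep-ordered {x = x} {y} x≤y F↭ xy<R with select-from-↭ F↭
  ... | R₁ , s₁ , R₁↭ with select-from-↭ R₁↭
  ... | R₂ , s₂ , R₂↭ = R₂ , huffStep s₁ x≤R₁ s₂ y≤R₂ , R₂↭
    where
    x≤R₁ : LowerBound x R₁
    x≤R₁ = All-resp-↭ (↭-sym R₁↭) (x≤y ∷ All.map (<⇒≤ ∘ proj₁) xy<R)
    y≤R₂ : LowerBound y R₂
    y≤R₂ = All-resp-↭ (↭-sym R₂↭) (All.map (<⇒≤ ∘ proj₂) xy<R)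

  huffStep-exists : ∀ {F x y R} → F ↭ x ∷ y ∷ R → All (BothLighter x y) R →
                    ∃₂ λ a b → ∃ λ F' → HuffStep w F a b F' × SamePair (a , b) (x , y) × F' ↭ node a b ∷ R
  huffStep-exists {x = x} {y} F↭ xy<R with ≤-total (W x) (W y)
  ... | inj₁ x≤y =
    let R₂ , st , R₂↭ = huffStep-ordered x≤y F↭ xy<R
    in x , y , _ , st , inj₁ (refl , refl) , ↭-prep _ R₂↭
  ... | inj₂ y≤x =
    let R₂ , st , R₂↭ = huffStep-ordered y≤x (↭-trans F↭ (↭-swap x y ↭-refl)) (All.map ×-swap xy<R)
    in y , x , _ , st , inj₂ (refl , refl) , ↭-prep _ R₂↭

  ¬huffStep-singleton : ∀ {t a b F'} → ¬ HuffStep w [ t ] a b F'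
  ¬huffStep-singleton (huffStep here        _ () _)
  ¬huffStep-singleton (huffStep (there ()) _ _  _)

leaves : ℕ → List Tree
leaves n = map leaf (upTo n)

leaves-suc : ∀ m → leaves (suc m) ↭ leaf m ∷ leaves m
leaves-suc m = begin
  leaves (suc m)          ≡⟨ cong (map leaf) (sym (upTo-∷ʳ m)) ⟩
  map leaf (upTo m ∷ʳ m)  ≡⟨ map-++ leaf (upTo m) [ m ] ⟩
  leaves m ∷ʳ leaf m      ↭⟨ ↭-sym (∷↭∷ʳ (leaf m) (leaves m)) ⟩
  leaf m ∷ leaves m       ∎
  where open PermutationReasoning

combFrom : Tree → ℕ → Tree
combFrom Y zero    = Y
combFrom Y (suc m) = combFrom (node Y (leaf m)) m

combMergesFrom : Tree → ℕ → List (Tree × Tree)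
combMergesFrom Y zero    = []
combMergesFrom Y (suc m) = (Y , leaf m) ∷ combMergesFrom (node Y (leaf m)) m

combMerge : ℕ → ℕ → Tree × Tree
combMerge M k = chain M k , leaf (M ∸ suc k)

module _ {M : ℕ} where

  chain-leafIndex : ∀ k m → k + suc m ≡ M → M ∸ suc k ≡ m
  chain-leafIndex k m refl = trans (cong (_∸ suc k) (+-suc k m)) (m+n∸m≡n (suc k) m)

  chain-suc : ∀ k m → k + suc m ≡ M → node (chain M k) (leaf m) ≡ chain M (suc k)
  chain-suc k m e = cong (λ i → node (chain M k) (leaf i)) (sym (chain-leafIndex k m e))

  combFrom-chain : ∀ k n → k + n ≡ M → combFrom (chain M k) n ≡ chain M M
  combFrom-chain k zero    e = cong (chain M) (trans (sym (+-identityʳ k)) e)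
  combFrom-chain k (suc m) e = trans (cong (λ t → combFrom t m) (chain-suc k m e))
                                     (combFrom-chain (suc k) m (trans (sym (+-suc k m)) e))

  combMergesFrom-chain : ∀ k n → k + n ≡ M →
                         combMergesFrom (chain M k) n ≡ applyUpTo (combMerge M ∘ (_+ k)) n
  combMergesFrom-chain k zero    e = refl
  combMergesFrom-chain k (suc m) e =
    cong₂ _∷_ (cong (λ i → chain M k , leaf i) (sym (chain-leafIndex k m e))) (begin
      combMergesFrom (node (chain M k) (leaf m)) m  ≡⟨ cong (λ t → combMergesFrom t m) (chain-suc k m e) ⟩
      combMergesFrom (chain M (suc k)) m            ≡⟨ combMergesFrom-chain (suc k) m (trans (sym (+-suc k m)) e) ⟩
      applyUpTo (combMerge M ∘ (_+ suc k)) m        ≡⟨ applyUpTo-cong (λ j → cong (combMerge M) (+-suc j k)) m ⟩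
      applyUpTo (combMerge M ∘ (_+ k) ∘ suc) m      ∎)
    where open ≡-Reasoning

combMergesFrom-leaf : ∀ M → combMergesFrom (leaf M) M ≡ combMerges M
combMergesFrom-leaf M = begin
  combMergesFrom (chain M 0) M        ≡⟨ combMergesFrom-chain 0 M refl ⟩
  applyUpTo (combMerge M ∘ (_+ 0)) M  ≡⟨ applyUpTo-cong (cong (combMerge M) ∘ +-identityʳ) M ⟩
  applyUpTo (combMerge M) M           ≡⟨ sym (map-upTo (combMerge M) M) ⟩
  combMerges M                        ∎
  where open ≡-Reasoning

module FibonacciLikeWeights (M : ℕ) (w : ℕ → ℚ)
  (pos : ∀ i → i ≤ M → 0ℚ < w i)
  (dec : ∀ i → i + 1 ≤ M → w (i + 1) ≤ℚ w i)
  (fib : ∀ i → i + 2 ≤ M → w (i + 1) +ℚ w (i + 2) ≤ℚ w i) where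

  open HuffmanStep w

  w-suc≤ : ∀ i → suc i ≤ M → w (suc i) ≤ℚ w i
  w-suc≤ i rewrite +ℕ-comm 1 i = dec i

  w-fib : ∀ i → 2 + i ≤ M → w (suc i) +ℚ w (2 + i) ≤ℚ w i
  w-fib i rewrite +ℕ-comm 2 i | +ℕ-comm 1 i = fib i

  w-suc< : ∀ i → 2 + i ≤ M → w (suc i) < w i
  w-suc< i 2+i≤M = begin-strict
    w (suc i)                 ≡⟨ sym (+ℚ-identityʳ (w (suc i))) ⟩
    w (suc i) +ℚ 0ℚ           <⟨ +-monoʳ-< (w (suc i)) (pos (2 + i) 2+i≤M) ⟩
    w (suc i) +ℚ w (2 + i)    ≤⟨ w-fib i 2+i≤M ⟩
    w i                       ∎
    where open ≤-Reasoning

  w-antitone : ∀ {i j} → i ≤ j → j ≤ M → w j ≤ℚ w i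
  w-antitone i≤j = go (≤⇒≤′ i≤j)
    where
    go : ∀ {i j} → i ≤′ j → j ≤ M → w j ≤ℚ w i
    go ≤′-refl            _     = ≤-refl
    go (≤′-step {j} i≤′j) 1+j≤M = ≤-trans (w-suc≤ j 1+j≤M) (go i≤′j (<ℕ⇒≤ℕ 1+j≤M))

  w-strictlyAntitone : ∀ {i j} → i <ℕ j → j ≤ M → suc i <ℕ M → w j < w i
  w-strictlyAntitone {i} i<j j≤M 2+i≤M = ≤-<-trans (w-antitone i<j j≤M) (w-suc< i 2+i≤M)

  LighterExceptLast : ℕ → ℚ → Set
  LighterExceptLast n c = ∀ i → suc i <ℕ n → c < w i

  lighterExceptLast-init : LighterExceptLast M (w M)
  lighterExceptLast-init i 2+i≤M = w-strictlyAntitone (<ℕ⇒≤ℕ 2+i≤M) ≤ℕ-refl 2+i≤M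

  lighterExceptLast-step : ∀ m c → suc m ≤ M → LighterExceptLast (suc m) c →
                           LighterExceptLast m (c +ℚ w m)
  lighterExceptLast-step (suc (suc q)) c 3+q≤M c< i (s≤s (s≤s i≤q)) = begin-strict
    c +ℚ w (2 + q)           <⟨ +-monoˡ-< (w (2 + q)) (c< (suc q) ≤ℕ-refl) ⟩
    w (suc q) +ℚ w (2 + q)   ≤⟨ w-fib q (<ℕ⇒≤ℕ 3+q≤M) ⟩
    w q                      ≤⟨ w-antitone i≤q (m+n≤o⇒n≤o 3 3+q≤M) ⟩
    w i                      ∎
    where open ≤-Reasoning

  lighterExceptLast-merge : ∀ {m X a b} → suc m ≤ M → LighterExceptLast (suc m) (W X) →
                            SamePair (a , b) (X , leaf m) → LighterExceptLast m (W (node a b))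
  lighterExceptLast-merge {m} {X} 1+m≤M X< ab =
    subst (LighterExceptLast m) (sym (samePair-weight ab)) (lighterExceptLast-step m (W X) 1+m≤M X<)

  leaves-heavier : ∀ {m X} → suc m ≤ M → LighterExceptLast (suc m) (W X) →
                   All (BothLighter X (leaf m)) (leaves m)
  leaves-heavier {m} 1+m≤M X< = map⁺ (applyUpTo⁺₁ id m λ {i} i<m →
    X< i (s≤s i<m) , w-strictlyAntitone i<m (<ℕ⇒≤ℕ 1+m≤M) (≤ℕ-trans (s≤s i<m) 1+m≤M))

  run-forced : ∀ n {F X Y ms T} → n ≤ M → LighterExceptLast n (W X) → X ≅ Y →
               F ↭ X ∷ leaves n → HuffRun w F ms T →
               Pointwise SameMerge ms (combMergesFrom Y n) × T ≅ combFrom Y n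
  run-forced zero _ _ X≅Y F↭ done with refl ← ↭-singleton-inv F↭ = [] , X≅Y
  run-forced zero _ _ _ F↭ (step st _) with refl ← ↭-singleton-inv F↭ = ⊥-elim (¬huffStep-singleton st)
  run-forced (suc m) _ _ _ F↭ done with ↭-length F↭
  ... | ()
  run-forced (suc m) {X = X} 1+m≤M X< X≅Y F↭ (step st run)
    with huffStep-forced st (↭-trans F↭ (↭-prep _ (leaves-suc m))) (leaves-heavier {X = X} 1+m≤M X<)
  ... | ab , F'↭
    with run-forced m (<ℕ⇒≤ℕ 1+m≤M) (lighterExceptLast-merge 1+m≤M X< ab)
                    (samePair-node≅ ab X≅Y leaf) F'↭ run
  ... | merges , T≅ = samePair-sameMerge ab X≅Y leaf ∷ merges , T≅

  run-exists : ∀ n {F X} → n ≤ M → LighterExceptLast n (W X) → F ↭ X ∷ leaves n →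
               ∃₂ λ ms T → HuffRun w F ms T
  run-exists zero _ _ F↭ with refl ← ↭-singleton-inv F↭ = [] , _ , done
  run-exists (suc m) {X = X} 1+m≤M X< F↭
    with huffStep-exists (↭-trans F↭ (↭-prep _ (leaves-suc m))) (leaves-heavier {X = X} 1+m≤M X<)
  ... | _ , _ , _ , st , ab , F'↭
    with run-exists m (<ℕ⇒≤ℕ 1+m≤M) (lighterExceptLast-merge 1+m≤M X< ab) F'↭
  ... | _ , T , run = _ , T , step st run

lemma21 : (M : ℕ) → 1 ≤ M → (w : ℕ → ℚ) →
          (∀ i → i ≤ M → 0ℚ < w i) →
          (∀ i → i + 1 ≤ M → w (i + 1) ≤ℚ w i) →
          (∀ i → i + 2 ≤ M → w (i + 1) +ℚ w (i + 2) ≤ℚ w i) →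
          Σ (List (Tree × Tree)) (λ ms → Σ Tree (λ T → HuffRun w (initialForest M) ms T))
          × (∀ ms T → HuffRun w (initialForest M) ms T →
               Pointwise SameMerge ms (combMerges M) × T ≅ chain M M)
lemma21 M _ w pos dec fib = run-exists M ≤ℕ-refl lighterExceptLast-init (leaves-suc M) , forced
  where
  open FibonacciLikeWeights M w pos dec fib

  forced : ∀ ms T → HuffRun w (initialForest M) ms T →
           Pointwise SameMerge ms (combMerges M) × T ≅ chain M M
  forced ms T run =
    let merges , T≅ = run-forced M ≤ℕ-refl lighterExceptLast-init leaf (leaves-suc M) run
    in subst (Pointwise SameMerge ms) (combMergesFrom-leaf M) merges
     , subst (T ≅_) (combFrom-chain 0 M refl) T≅
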